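{- Let $H$ be a bipartite graph and let $G$ be the complement of $H$. If $G$ contains no induced subgraph isomorphic to $C_4$, then $\chi_{FF}(G)\geq \delta(G)+1$.
   Context: All graphs are finite, simple and undirected. $C_4$ is the cycle on 4 vertices; the complement $\overline{H}$ has the same vertex set as $H$, with two distinct vertices adjacent iff they are non-adjacent in $H$. $\delta(G)$ is the minimum degree. A Grundy $k$-coloring of $G$ is a proper coloring with colors $\{1,\dots,k\}$ such that for any $i<j$, every vertex colored $j$ has a neighbor colored $i$; $\chi_{FF}(G)$ (the First-Fit or Grundy chromatic number) is the largest $k$ for which a Grundy $k$-coloring exists. -}

module Defs where

open import Data.Nat using (ℕ; suc; _⊓_)
open import Data.Bool using (Bool; true; false; not; _∧_; T)
open import Data.Fin using (Fin)
open import Data.Fin.Properties using (_≟_)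
open import Data.Vec using (Vec; tabulate; foldr₁; countᵇ; allFin)
open import Data.Product using (Σ; _×_)
open import Relation.Nullary using (¬_; does; yes; no)
open import Relation.Binary.PropositionalEquality using (_≡_; _≢_; refl; sym; cong; cong₂)
open import Function.Definitions using (Injective)

record Graph (n : ℕ) : Set where
  field
    adj    : Fin n → Fin n → Bool
    adj-sym    : ∀ u v → adj u v ≡ adj v u
    adj-irrefl : ∀ v → adj v v ≡ false
open Graph public

private
  ≟-sym : ∀ {n} (u v : Fin n) → does (u ≟ v) ≡ does (v ≟ u)
  ≟-sym u v with u ≟ v | v ≟ u
  ... | yes _ | yes _ = refl
  ... | no _  | no _  = refl
  ... | yes p | no q  with q (sym p)
  ... | ()
  ≟-sym u v | no q | yes p with q (sym p)
  ... | ()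

  ≟-refl : ∀ {n} (v : Fin n) → does (v ≟ v) ≡ true
  ≟-refl v with v ≟ v
  ... | yes _ = refl
  ... | no q with q refl
  ... | ()

  ∧-false : ∀ b → b ∧ false ≡ false
  ∧-false true = refl
  ∧-false false = refl

complement : ∀ {n} → Graph n → Graph n
complement H = record
  { adj        = λ u v → not (adj H u v) ∧ not (does (u ≟ v))
  ; adj-sym    = λ u v → cong₂ (λ a b → not a ∧ not b) (adj-sym H u v) (≟-sym u v)
  ; adj-irrefl = λ v → helper v
  }
  where
  helper : ∀ v → not (adj H v v) ∧ not (does (v ≟ v)) ≡ false
  helper v with does (v ≟ v) | ≟-refl v
  ... | .true | refl = ∧-false (not (adj H v v))

Bipartite : ∀ {n} → Graph n → Set
Bipartite {n} H = Σ (Fin n → Bool) λ side →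
  ∀ u v → T (adj H u v) → side u ≢ side v

C4adj : Fin 4 → Fin 4 → Bool
C4adj Fin.zero (Fin.suc Fin.zero) = true
C4adj (Fin.suc Fin.zero) Fin.zero = true
C4adj (Fin.suc Fin.zero) (Fin.suc (Fin.suc Fin.zero)) = true
C4adj (Fin.suc (Fin.suc Fin.zero)) (Fin.suc Fin.zero) = true
C4adj (Fin.suc (Fin.suc Fin.zero)) (Fin.suc (Fin.suc (Fin.suc Fin.zero))) = true
C4adj (Fin.suc (Fin.suc (Fin.suc Fin.zero))) (Fin.suc (Fin.suc Fin.zero)) = true
C4adj (Fin.suc (Fin.suc (Fin.suc Fin.zero))) Fin.zero = true
C4adj Fin.zero (Fin.suc (Fin.suc (Fin.suc Fin.zero))) = true
C4adj _ _ = false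

HasInducedC4 : ∀ {n} → Graph n → Set
HasInducedC4 {n} G = Σ (Fin 4 → Fin n) λ φ →
  Injective _≡_ _≡_ φ × (∀ i j → adj G (φ i) (φ j) ≡ C4adj i j)

degree : ∀ {n} → Graph n → Fin n → ℕ
degree {n} G v = countᵇ (adj G v) (allFin n)

minDegree : ∀ {m} → Graph (suc m) → ℕ
minDegree {m} G = foldr₁ _⊓_ (tabulate (degree G))

-- Grundy k-colouring with colours Fin k (colour i stands for i+1):
-- proper, every colour is used, and every vertex of colour j has a
-- neighbour of colour i for every i < j.
record GrundyColoring {n} (G : Graph n) (k : ℕ) : Set where
  field
    col      : Fin n → Fin k
    proper   : ∀ u v → T (adj G u v) → col u ≢ col v
    surj     : ∀ (c : Fin k) → Σ (Fin n) λ v → col v ≡ c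
    grundy   : ∀ v (i : Fin k) → i Data.Fin.< col v →
               Σ (Fin n) λ u → T (adj G v u) × col u ≡ i

-- Colour G greedily (First-Fit in the order of the vertices): this is a Grundy colouring, and in
-- any proper colouring a vertex whose neighbourhood is a clique has fewer neighbours than there
-- are colours.  Such a vertex exists when G is the complement of a bipartite graph with sides
-- A and B and G has no induced C₄: for a, a' ∈ A the G-neighbourhoods of a and a' in B are
-- comparable under inclusion (if b ∈ N(a) ∖ N(a') and b' ∈ N(a') ∖ N(a), then a b b' a' is an
-- induced C₄), so some v ∈ A has the smallest one.  Then N(v) is a clique: A and B are cliques
-- in G, and every neighbour of v in B is a neighbour of every vertex of A.
module Submission where

open import Defs
open import Data.Bool using (Bool; true; false; T)
open import Data.Bool.Properties using (¬-not) renaming (_≟_ to _≟ᵇ_)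
open import Data.Empty using (⊥-elim)
open import Data.Fin as Fin using (Fin; zero; suc; toℕ; fromℕ<; punchOut)
open import Data.Fin.Patterns using (0F; 1F; 2F; 3F)
open import Data.Fin.Properties
  using (_≟_; any?; ¬Fin0; 0≢1+n; suc-injective; toℕ-injective; toℕ-fromℕ<; toℕ<n; punchOut-injective)
open import Data.Nat using (ℕ; zero; suc; _≤_; _<_; z≤n; s≤s; _⊓_)
open import Data.Nat.Properties
  using (≤-refl; ≤-trans; ≤-total; ≤-pred; <-irrefl; ≤-<-trans; ≤∧≢⇒<; <-cmp; m⊓n≤m; m⊓n≤n; m≤n⇒m<n∨m≡n)
  renaming (_≟_ to _≟ℕ_; _<?_ to _<ℕ?_)
open import Data.Product using (Σ; ∃; _×_; _,_; proj₁; proj₂)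
open import Data.Sum as Sum using (_⊎_; inj₁; inj₂)
open import Data.Unit using (tt)
open import Data.Vec using (tabulate; countᵇ; foldr₁)
open import Function using (_∘_; id)
open import Function.Definitions using (Injective)
open import Level using (0ℓ)
open import Relation.Binary using (Rel; Reflexive; Transitive; tri<; tri≈; tri>)
open import Relation.Binary.PropositionalEquality using (_≡_; _≢_; refl; sym; trans; cong; subst)
open import Relation.Nullary using (¬_; Dec; yes; no; contradiction)
open import Relation.Nullary.Decidable using (_×-dec_; T?; ¬?)
open import Relation.Unary using (Pred; Decidable)

private
  variable
    n : ℕ

Adj : Graph n → Fin n → Fin n → Set
Adj G u v = T (adj G u v)

Adj? : (G : Graph n) → ∀ u v → Dec (Adj G u v)
Adj? G u v = T? (adj G u v)

Adj-sym : (G : Graph n) → ∀ {u v} → Adj G u v → Adj G v u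
Adj-sym G {u} {v} = subst T (adj-sym G u v)

Adj-irrefl : (G : Graph n) → ∀ {v} → ¬ Adj G v v
Adj-irrefl G {v} = subst T (adj-irrefl G v)

Adj⇒≢ : (G : Graph n) → ∀ {u v} → Adj G u v → u ≢ v
Adj⇒≢ G uv refl = Adj-irrefl G uv

Adj⇒adj≡true : (G : Graph n) → ∀ {u v} → Adj G u v → adj G u v ≡ true
Adj⇒adj≡true G {u} {v} uv with adj G u v
... | true = refl

¬Adj⇒adj≡false : (G : Graph n) → ∀ {u v} → ¬ Adj G u v → adj G u v ≡ false
¬Adj⇒adj≡false G {u} {v} ¬uv with adj G u v
... | true  = contradiction tt ¬uv
... | false = refl

record Mex (U : ℕ → Set) (b : ℕ) : Set where
  field
    value        : ℕ
    value≤b      : value ≤ b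
    below-used   : ∀ {j} → j < value → U j
    free-or-cap  : ¬ U value ⊎ value ≡ b

mex : {U : ℕ → Set} → (∀ i → Dec (U i)) → ∀ b → Mex U b
mex U? zero = record { value = 0 ; value≤b = z≤n ; below-used = λ () ; free-or-cap = inj₂ refl }
mex U? (suc b) with U? 0
... | no ¬U0 = record { value = 0 ; value≤b = z≤n ; below-used = λ () ; free-or-cap = inj₁ ¬U0 }
... | yes U0 = record
  { value       = suc value
  ; value≤b     = s≤s value≤b
  ; below-used  = λ { {zero} _ → U0 ; {suc j} j<v → below-used (≤-pred j<v) }
  ; free-or-cap = Sum.map id (cong suc) free-or-cap
  }
  where open Mex (mex (U? ∘ suc) b)

record IsGrundyLabelling (G : Graph n) (c : Fin n → ℕ) : Set where
  field
    proper : ∀ u v → Adj G u v → c u ≢ c v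
    grundy : ∀ v {i} → i < c v → ∃ λ u → Adj G v u × c u ≡ i

module FirstFit (G : Graph n) where

  UsedBefore : (Fin n → ℕ) → Fin n → ℕ → Set
  UsedBefore c w i = ∃ λ v → toℕ v < toℕ w × Adj G w v × c v ≡ i

  UsedBefore? : ∀ c w i → Dec (UsedBefore c w i)
  UsedBefore? c w i = any? λ v → (toℕ v <ℕ? toℕ w) ×-dec Adj? G w v ×-dec (c v ≟ℕ i)

  firstFree : (c : Fin n → ℕ) (w : Fin n) → Mex (UsedBefore c w) (toℕ w)
  firstFree c w = mex (UsedBefore? c w) (toℕ w)

  -- prefix k has coloured the vertices w with toℕ w < k
  prefix : ℕ → Fin n → ℕ
  prefix zero    w = 0
  prefix (suc k) w with toℕ w ≟ℕ k
  ... | yes _ = Mex.value (firstFree (prefix k) w)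
  ... | no  _ = prefix k w

  colour : Fin n → ℕ
  colour w = Mex.value (firstFree (prefix (toℕ w)) w)

  prefix≡colour : ∀ k v → toℕ v < k → prefix k v ≡ colour v
  prefix≡colour (suc k) v v<1+k with toℕ v ≟ℕ k
  ... | yes refl = refl
  ... | no  v≢k  = prefix≡colour k v (≤∧≢⇒< (≤-pred v<1+k) v≢k)

  colour≤ : ∀ w → colour w ≤ toℕ w
  colour≤ w = Mex.value≤b (firstFree (prefix (toℕ w)) w)

  colour-grundy : ∀ w {i} → i < colour w → ∃ λ v → toℕ v < toℕ w × Adj G w v × colour v ≡ i
  colour-grundy w i<c with Mex.below-used (firstFree (prefix (toℕ w)) w) i<c
  ... | v , v<w , wv , e = v , v<w , wv , trans (sym (prefix≡colour (toℕ w) v v<w)) e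

  -- A vertex that finds no free colour below its index gets its index, which exceeds every
  -- colour of an earlier vertex.
  colour-fresh : ∀ {w v} → toℕ v < toℕ w → Adj G w v → colour v ≢ colour w
  colour-fresh {w} {v} v<w wv cv≡cw with Mex.free-or-cap (firstFree (prefix (toℕ w)) w)
  ... | inj₁ free  = free (v , v<w , wv , trans (prefix≡colour (toℕ w) v v<w) cv≡cw)
  ... | inj₂ capped = <-irrefl (trans cv≡cw capped) (≤-<-trans (colour≤ v) v<w)

  colour-proper : ∀ u v → Adj G u v → colour u ≢ colour v
  colour-proper u v uv with <-cmp (toℕ u) (toℕ v)
  ... | tri< u<v _ _ = colour-fresh u<v (Adj-sym G uv)
  ... | tri≈ _ u≡v _ = contradiction (toℕ-injective u≡v) (Adj⇒≢ G uv)
  ... | tri> _ _ v<u = colour-fresh v<u uv ∘ sym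

  isGrundyLabelling : IsGrundyLabelling G colour
  isGrundyLabelling = record
    { proper = colour-proper
    ; grundy = λ w i<c → let v , _ , wv , cv≡i = colour-grundy w i<c in v , wv , cv≡i
    }

argmax : ∀ {m} (f : Fin (suc m) → ℕ) → ∃ λ v → ∀ u → f u ≤ f v
argmax {zero}  f = zero , λ { zero → ≤-refl }
argmax {suc m} f with argmax (f ∘ suc)
... | v , max with ≤-total (f zero) (f (suc v))
...   | inj₁ f0≤ = suc v , λ { zero → f0≤ ; (suc u) → max u }
...   | inj₂ ≤f0 = zero  , λ { zero → ≤-refl ; (suc u) → ≤-trans (max u) ≤f0 }

grundyColouring : ∀ {m} {G : Graph (suc m)} {c : Fin (suc m) → ℕ} →
                  IsGrundyLabelling G c → ∃ λ k → GrundyColoring G (suc k)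
grundyColouring {m} {G} {c} isGrundy =
  c top , record { col = col ; proper = proper′ ; surj = surj ; grundy = grundy′ }
  where
  open IsGrundyLabelling isGrundy
  top = proj₁ (argmax c)

  col : Fin (suc m) → Fin (suc (c top))
  col u = fromℕ< (s≤s (proj₂ (argmax c) u))

  toℕ-col : ∀ u → toℕ (col u) ≡ c u
  toℕ-col u = toℕ-fromℕ< (s≤s (proj₂ (argmax c) u))

  col≡ : ∀ {u} {i : Fin (suc (c top))} → c u ≡ toℕ i → col u ≡ i
  col≡ {u} cu≡i = toℕ-injective (trans (toℕ-col u) cu≡i)

  proper′ : ∀ u v → Adj G u v → col u ≢ col v
  proper′ u v uv e = proper u v uv (trans (sym (toℕ-col u)) (trans (cong toℕ e) (toℕ-col v)))

  surj : ∀ i → ∃ λ v → col v ≡ i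
  surj i with m≤n⇒m<n∨m≡n (≤-pred (toℕ<n i))
  ... | inj₂ i≡max = top , col≡ (sym i≡max)
  ... | inj₁ i<max = let v , _ , cv≡i = grundy top i<max in v , col≡ cv≡i

  grundy′ : ∀ v i → i Fin.< col v → ∃ λ u → Adj G v u × col u ≡ i
  grundy′ v i i<cv with grundy v (subst (toℕ i <_) (toℕ-col v) i<cv)
  ... | u , vu , cu≡i = u , vu , col≡ cu≡i

grundyColouring-exists : ∀ {m} (G : Graph (suc m)) → ∃ λ k → GrundyColoring G (suc k)
grundyColouring-exists G = grundyColouring (FirstFit.isGrundyLabelling G)

countᵇ-tabulate≤ : ∀ {A : Set} {k} (P : A → Bool) (h : Fin n → A)
                   (f : ∀ u → T (P (h u)) → Fin k) →
                   (∀ {u v} pu pv → f u pu ≡ f v pv → u ≡ v) →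
                   countᵇ P (tabulate h) ≤ k
countᵇ-tabulate≤ {n = zero}  P h f f-inj = z≤n
countᵇ-tabulate≤ {n = suc n} P h f f-inj with P (h zero) in P₀
... | false = countᵇ-tabulate≤ P (h ∘ suc) (f ∘ suc) (λ pu pv → suc-injective ∘ f-inj pu pv)
... | true  = tail< f f-inj (subst T (sym P₀) tt)
  where
  tail< : ∀ {k} (f : ∀ u → T (P (h u)) → Fin k) → (∀ {u v} pu pv → f u pu ≡ f v pv → u ≡ v) →
          T (P (h zero)) → suc (countᵇ P (tabulate (h ∘ suc))) ≤ k
  tail< {zero}  f _     p₀ = ⊥-elim (¬Fin0 (f zero p₀))
  tail< {suc k} f f-inj p₀ = s≤s (countᵇ-tabulate≤ P (h ∘ suc) f′ f′-inj)
    where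
    avoids : ∀ {u} pu → f zero p₀ ≢ f (suc u) pu
    avoids pu = 0≢1+n ∘ f-inj p₀ pu

    f′ : ∀ u → T (P (h (suc u))) → Fin k
    f′ u pu = punchOut (avoids pu)

    f′-inj : ∀ {u v} pu pv → f′ u pu ≡ f′ v pv → u ≡ v
    f′-inj pu pv = suc-injective ∘ f-inj pu pv ∘ punchOut-injective (avoids pu) (avoids pv)

foldr₁-⊓-tabulate≤ : ∀ {m} (f : Fin (suc m) → ℕ) v → foldr₁ _⊓_ (tabulate f) ≤ f v
foldr₁-⊓-tabulate≤ {zero}  f zero    = ≤-refl
foldr₁-⊓-tabulate≤ {suc m} f zero    = m⊓n≤m (f zero) _
foldr₁-⊓-tabulate≤ {suc m} f (suc v) = ≤-trans (m⊓n≤n (f zero) _) (foldr₁-⊓-tabulate≤ (f ∘ suc) v)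

-- v and its neighbours get pairwise distinct colours, and punchOut removes the colour of v.
degree≤colours : ∀ {k} (G : Graph n) (col : Fin n → Fin (suc k)) →
                 (∀ u w → Adj G u w → col u ≢ col w) →
                 ∀ v → (∀ {u w} → Adj G v u → Adj G v w → u ≢ w → Adj G u w) →
                 degree G v ≤ k
degree≤colours G col proper v clique = countᵇ-tabulate≤ (adj G v) id f f-inj
  where
  f : ∀ u → Adj G v u → Fin _
  f u vu = punchOut (proper v u vu)

  f-inj : ∀ {u w} vu vw → f u vu ≡ f w vw → u ≡ w
  f-inj {u} {w} vu vw e with u ≟ w
  ... | yes u≡w = u≡w
  ... | no  u≢w = contradiction (punchOut-injective (proper v u vu) (proper v w vw) e)
                                (proper u w (clique vu vw u≢w))

inducedC4 : (G : Graph n) → ∀ {w x y z} →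
            Adj G w x → Adj G x y → Adj G y z → Adj G z w →
            ¬ Adj G w y → ¬ Adj G x z → w ≢ y → x ≢ z → HasInducedC4 G
inducedC4 G {w} {x} {y} {z} wx xy yz zw ¬wy ¬xz w≢y x≢z = φ , φ-injective , φ-adj
  where
  φ : Fin 4 → _
  φ 0F = w
  φ 1F = x
  φ 2F = y
  φ 3F = z

  edge : ∀ {u v} → Adj G u v → adj G v u ≡ true
  edge = Adj⇒adj≡true G ∘ Adj-sym G

  non-edge : ∀ {u v} → ¬ Adj G u v → adj G v u ≡ false
  non-edge ¬uv = ¬Adj⇒adj≡false G (¬uv ∘ Adj-sym G)

  φ-adj : ∀ i j → adj G (φ i) (φ j) ≡ C4adj i j
  φ-adj 0F 0F = adj-irrefl G w
  φ-adj 0F 1F = Adj⇒adj≡true G wx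
  φ-adj 0F 2F = ¬Adj⇒adj≡false G ¬wy
  φ-adj 0F 3F = edge zw
  φ-adj 1F 0F = edge wx
  φ-adj 1F 1F = adj-irrefl G x
  φ-adj 1F 2F = Adj⇒adj≡true G xy
  φ-adj 1F 3F = ¬Adj⇒adj≡false G ¬xz
  φ-adj 2F 0F = non-edge ¬wy
  φ-adj 2F 1F = edge xy
  φ-adj 2F 2F = adj-irrefl G y
  φ-adj 2F 3F = Adj⇒adj≡true G yz
  φ-adj 3F 0F = Adj⇒adj≡true G zw
  φ-adj 3F 1F = non-edge ¬xz
  φ-adj 3F 2F = edge yz
  φ-adj 3F 3F = adj-irrefl G z

  diagonal-distinct : ∀ i j → i ≢ j → C4adj i j ≡ false → φ i ≢ φ j
  diagonal-distinct 0F 2F _ _ = w≢y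
  diagonal-distinct 2F 0F _ _ = w≢y ∘ sym
  diagonal-distinct 1F 3F _ _ = x≢z
  diagonal-distinct 3F 1F _ _ = x≢z ∘ sym
  diagonal-distinct 0F 0F i≢j _ = contradiction refl i≢j
  diagonal-distinct 1F 1F i≢j _ = contradiction refl i≢j
  diagonal-distinct 2F 2F i≢j _ = contradiction refl i≢j
  diagonal-distinct 3F 3F i≢j _ = contradiction refl i≢j
  diagonal-distinct 0F 1F _ ()
  diagonal-distinct 0F 3F _ ()
  diagonal-distinct 1F 0F _ ()
  diagonal-distinct 1F 2F _ ()
  diagonal-distinct 2F 1F _ ()
  diagonal-distinct 2F 3F _ ()
  diagonal-distinct 3F 0F _ ()
  diagonal-distinct 3F 2F _ ()

  φ-injective : Injective _≡_ _≡_ φ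
  φ-injective {i} {j} φi≡φj with i Fin.≟ j | C4adj i j in ij
  ... | yes i≡j | _     = i≡j
  ... | no  _   | true  = contradiction φi≡φj (Adj⇒≢ G (subst T (sym (trans (φ-adj i j) ij)) tt))
  ... | no  i≢j | false = contradiction φi≡φj (diagonal-distinct i j i≢j ij)

least : ∀ {Q : Pred (Fin n) 0ℓ} {R : Rel (Fin n) 0ℓ} → Decidable Q →
        Reflexive R → Transitive R → (∀ {x y} → Q x → Q y → R x y ⊎ R y x) →
        ∃ Q → ∃ λ v → Q v × ∀ {u} → Q u → R v u
least {zero}  Q? refl′ trans′ total (() , _)
least {suc n} {Q} Q? refl′ trans′ total (x , qx) with any? (Q? ∘ suc)
... | no none = zero , Q0 x qx , λ { {zero} _ → refl′ ; {suc u} qu → contradiction (u , qu) none }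
  where
  Q0 : ∀ x → Q x → Q zero
  Q0 zero    qx = qx
  Q0 (suc x) qx = contradiction (x , qx) none
... | yes some with least (Q? ∘ suc) refl′ trans′ total some | Q? zero
...   | v , qv , v-least | no ¬q0 =
        suc v , qv , λ { {zero} q0 → contradiction q0 ¬q0 ; {suc u} qu → v-least qu }
...   | v , qv , v-least | yes q0 with total q0 qv
...     | inj₁ 0≤v = zero  , q0 , λ { {zero} _ → refl′ ; {suc u} qu → trans′ 0≤v (v-least qu) }
...     | inj₂ v≤0 = suc v , qv , λ { {zero} _ → v≤0 ; {suc u} qu → v-least qu }

≢-≢⇒≡ : ∀ {x y s : Bool} → x ≢ s → y ≢ s → x ≡ y
≢-≢⇒≡ x≢s y≢s = trans (¬-not x≢s) (sym (¬-not y≢s))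

module BipartiteComplement (H : Graph n) (side : Fin n → Bool)
  (side-proper : ∀ u v → T (adj H u v) → side u ≢ side v) where

  G : Graph n
  G = complement H

  sameSide⇒Adj : ∀ {u v} → side u ≡ side v → u ≢ v → Adj G u v
  sameSide⇒Adj {u} {v} su≡sv u≢v with adj H u v in uv
  ... | true = side-proper u v (subst T (sym uv) tt) su≡sv
  ... | false with u ≟ v
  ...   | yes u≡v = u≢v u≡v
  ...   | no  _   = tt

  module _ (s : Bool) where

    _⊑_ : Rel (Fin n) 0ℓ
    u ⊑ w = ∀ {b} → side b ≢ s → Adj G u b → Adj G w b

    ⊑-refl : Reflexive _⊑_
    ⊑-refl _ ub = ub

    ⊑-trans : Transitive _⊑_
    ⊑-trans u⊑v v⊑w sb = v⊑w sb ∘ u⊑v sb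

    ⊑-total : ¬ HasInducedC4 G → ∀ {a a'} → side a ≡ s → side a' ≡ s → a ⊑ a' ⊎ a' ⊑ a
    ⊑-total noC4 {a} {a'} sa sa'
      with any? (λ b → ¬? (side b ≟ᵇ s) ×-dec Adj? G a b ×-dec ¬? (Adj? G a' b))
    ... | no none = inj₁ λ {b} sb ab → case b sb ab
      where
      case : ∀ b → side b ≢ s → Adj G a b → Adj G a' b
      case b sb ab with Adj? G a' b
      ... | yes a'b = a'b
      ... | no ¬a'b = contradiction (b , sb , ab , ¬a'b) none
    ... | yes (b , sb , ab , ¬a'b) = inj₂ λ {b'} sb' a'b' → case b' sb' a'b'
      where
      case : ∀ b' → side b' ≢ s → Adj G a' b' → Adj G a b'
      case b' sb' a'b' with Adj? G a b'
      ... | yes ab' = ab'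
      ... | no ¬ab' = contradiction
        (inducedC4 G ab (sameSide⇒Adj (≢-≢⇒≡ sb sb') (λ { refl → ¬ab' ab }))
                   (Adj-sym G a'b') (sameSide⇒Adj (trans sa' (sym sa)) (λ { refl → ¬a'b ab }))
                   ¬ab' (¬a'b ∘ Adj-sym G)
                   (λ { refl → sb' sa }) (λ { refl → sb sa' }))
        noC4

  ∃-clique-neighbourhood : ¬ HasInducedC4 G → Fin n →
                           ∃ λ v → ∀ {u w} → Adj G v u → Adj G v w → u ≢ w → Adj G u w
  ∃-clique-neighbourhood noC4 v₀ = v , clique
    where
    s = side v₀
    v-min = least {R = _⊑_ s} (λ x → side x ≟ᵇ s) (⊑-refl s) (⊑-trans s) (⊑-total s noC4) (v₀ , refl)
    v = proj₁ v-min
    v-least = proj₂ (proj₂ v-min)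

    clique : ∀ {u w} → Adj G v u → Adj G v w → u ≢ w → Adj G u w
    clique {u} {w} vu vw u≢w with side u ≟ᵇ side w | side u ≟ᵇ s
    ... | yes su≡sw | _      = sameSide⇒Adj su≡sw u≢w
    ... | no  su≢sw | yes su = v-least su (λ sw → su≢sw (trans su (sym sw))) vw
    ... | no  su≢sw | no  su≢s =
          Adj-sym G (v-least (≢-≢⇒≡ (su≢sw ∘ sym) (su≢s ∘ sym)) su≢s vu)

theorem9 : ∀ {m} (H : Graph (suc m)) → Bipartite H →
    ¬ HasInducedC4 (complement H) →
    Σ ℕ λ k → suc (minDegree (complement H)) ≤ k × GrundyColoring (complement H) k
theorem9 H (side , side-proper) noC4 =
  let open BipartiteComplement H side side-proper
      k , γ      = grundyColouring-exists G
      v , clique = ∃-clique-neighbourhood noC4 zero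
      deg≤k      = degree≤colours G (GrundyColoring.col γ) (GrundyColoring.proper γ) v clique
  in suc k , s≤s (≤-trans (foldr₁-⊓-tabulate≤ (degree G) v) deg≤k) , γ
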